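{- If $n$ is even and $G$ is a connected graph, then B wins the gp achievement game on $K_n\,\square\,G$.
   Context: A general position set of a graph $G$ is a set $S\subseteq V(G)$ such that no three vertices of $S$ lie on a common shortest path of $G$. The gp achievement game on a graph: players A and B alternately select vertices, A first; a selection is legal if the vertex has not been selected before and the set of all vertices selected so far (including it) is a general position set. The game ends when no legal move exists, and the player who selected the last vertex wins; "a player wins the game" means that player has a winning strategy. The Cartesian product $G\,\square\,H$ has vertex set $V(G)\times V(H)$, with $(g_1,h_1)$ adjacent to $(g_2,h_2)$ iff either $g_1g_2\in E(G)$ and $h_1=h_2$, or $g_1=g_2$ and $h_1h_2\in E(H)$. $K_n$ is the complete graph on $n$ vertices. -}

module Defs where

open import Data.Nat using (ℕ; zero; suc; _<_; _+_)
open import Data.Fin using (Fin)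
open import Data.Fin.Properties using () renaming (_≟_ to _≟ᶠ_)
open import Data.Bool using (Bool; true; false; _∧_; _∨_; not)
open import Data.Product using (_×_; _,_; Σ; ∃; ∃-syntax)
open import Data.Product.Properties using (≡-dec)
open import Data.List using (List; []; _∷_)
open import Data.List.Membership.Propositional using (_∈_; _∉_)
open import Relation.Binary.PropositionalEquality using (_≡_; _≢_)
open import Relation.Binary.Definitions using (DecidableEquality)
open import Relation.Nullary using (¬_)
open import Relation.Nullary.Decidable using (⌊_⌋)

record Graph (V : Set) : Set where
  field
    _≟_    : DecidableEquality V
    adj    : V → V → Bool
    adj-sym    : ∀ u v → adj u v ≡ adj v u
    adj-irrefl : ∀ u → adj u u ≡ false
open Graph public

K : (n : ℕ) → Graph (Fin n)
K n = record
  { _≟_ = _≟ᶠ_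
  ; adj = λ u v → not ⌊ u ≟ᶠ v ⌋
  ; adj-sym = sym'
  ; adj-irrefl = irr }
  where
  open import Relation.Nullary using (yes; no)
  open import Relation.Binary.PropositionalEquality using (refl; sym)
  sym' : ∀ u v → not ⌊ u ≟ᶠ v ⌋ ≡ not ⌊ v ≟ᶠ u ⌋
  sym' u v with u ≟ᶠ v | v ≟ᶠ u
  ... | yes _ | yes _ = refl
  ... | no _ | no _ = refl
  ... | yes p | no q with q (sym p)
  ... | ()
  sym' u v | no q | yes p with q (sym p)
  ... | ()
  irr : ∀ u → not ⌊ u ≟ᶠ u ⌋ ≡ false
  irr u with u ≟ᶠ u
  ... | yes _ = refl
  ... | no q with q refl
  ... | ()

_□_ : ∀ {V W} → Graph V → Graph W → Graph (V × W)
_□_ {V} {W} G H = record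
  { _≟_ = ≡-dec (_≟_ G) (_≟_ H)
  ; adj = a
  ; adj-sym = s
  ; adj-irrefl = i }
  where
  open import Relation.Nullary using (yes; no)
  open import Relation.Binary.PropositionalEquality using (refl; sym; cong₂)
  a : V × W → V × W → Bool
  a (g₁ , h₁) (g₂ , h₂) =
    (adj G g₁ g₂ ∧ ⌊ _≟_ H h₁ h₂ ⌋) ∨ (⌊ _≟_ G g₁ g₂ ⌋ ∧ adj H h₁ h₂)
  eqsym : ∀ {X : Set} (d : DecidableEquality X) x y → ⌊ d x y ⌋ ≡ ⌊ d y x ⌋
  eqsym d x y with d x y | d y x
  ... | yes _ | yes _ = refl
  ... | no _ | no _ = refl
  ... | yes p | no q with q (sym p)
  ... | ()
  eqsym d x y | no q | yes p with q (sym p)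
  ... | ()
  s : ∀ u v → a u v ≡ a v u
  s (g₁ , h₁) (g₂ , h₂) =
    cong₂ _∨_ (cong₂ _∧_ (adj-sym G g₁ g₂) (eqsym (_≟_ H) h₁ h₂))
              (cong₂ _∧_ (eqsym (_≟_ G) g₁ g₂) (adj-sym H h₁ h₂))
  i : ∀ u → a u u ≡ false
  i (g , h) rewrite adj-irrefl G g | adj-irrefl H h with ⌊ _≟_ G g g ⌋
  ... | true = refl
  ... | false = refl

module _ {V : Set} (G : Graph V) where

  data Walk : V → V → ℕ → Set where
    here : ∀ {u} → Walk u u zero
    step : ∀ {u w v k} → adj G u w ≡ true → Walk w v k → Walk u v (suc k)

  data OnWalk (x : V) : ∀ {u v k} → Walk u v k → Set where
    at-start : ∀ {v k} {p : Walk x v k} → OnWalk x p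
    later    : ∀ {u w v k} {e : adj G u w ≡ true} {p : Walk w v k} →
               OnWalk x p → OnWalk x (step e p)

  IsShortest : ∀ {u v k} → Walk u v k → Set
  IsShortest {u} {v} {k} _ = ∀ j → j < k → ¬ Walk u v j

  OnCommonShortestPath : V → V → V → Set
  OnCommonShortestPath x y z =
    Σ V λ u → Σ V λ v → Σ ℕ λ k → Σ (Walk u v k) λ p →
      IsShortest p × OnWalk x p × OnWalk y p × OnWalk z p

  Connected : Set
  Connected = ∀ u v → ∃[ k ] Walk u v k

  GeneralPosition : List V → Set
  GeneralPosition S = ∀ x y z → x ∈ S → y ∈ S → z ∈ S →
    x ≢ y → y ≢ z → x ≢ z → ¬ OnCommonShortestPath x y z

  Legal : List V → V → Set
  Legal S v = v ∉ S × GeneralPosition (v ∷ S)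

  -- gp achievement game, positions = lists of selected vertices.
  -- A player with no legal move loses (the last player to move wins).
  data MoverWins (S : List V) : Set
  data MoverLoses (S : List V) : Set
  data MoverWins S where
    move : ∀ v → Legal S v → MoverLoses (v ∷ S) → MoverWins S
  data MoverLoses S where
    allMoves : (∀ v → Legal S v → MoverWins (v ∷ S)) → MoverLoses S

  BWins : Set
  BWins = MoverLoses []

-- B wins by mirroring.  Fix a fixed-point-free involution σ of K_n (for even n,
-- i ↦ n − 1 − i) and answer every move (i , g) by (σ i , g).  The map
-- φ = σ × id is an automorphism of K_n □ G with every v adjacent to φ v, so by
-- induction the selected set S stays φ-symmetric and in general position: a
-- triple of S ∪ {a , φ a} through φ a is either the φ-image of a triple of
-- S ∪ {a}, or it contains both a and φ a.  In the latter case the product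
-- metric d((i , g) , (j , h)) = d_G(g , h) + [i ≠ j] shows that some z ∈ S
-- lies on a geodesic from a to φ z, again a forbidden triple.  Hence B always
-- has a reply, and as the game is finite B makes the last move.
module Submission where

open import Defs
open import Data.Nat using (ℕ; zero; suc; _+_; _*_; _∸_; _%_; _<_; _≤_; z≤n; s≤s)
open import Data.Nat.Properties
  using (+-comm; +-mono-≤; +-monoˡ-<; ≤-refl; ≤-trans; ≤-<-trans; ≤-pred;
         m≤n⇒m≤1+n; n≤1+n; m<n+m; m+[n∸m]≡n; *-suc; *-identityʳ; 0≢1+n)
open import Data.Nat.DivMod using ([m+kn]%n≡m%n)
open import Data.Fin using (Fin; toℕ; opposite)
open import Data.Fin.Properties using (opposite-prop; opposite-involutive; toℕ<n)
  renaming (_≟_ to _≟ᶠ_)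
open import Data.Bool using (true; false)
open import Data.Product using (Σ; _×_; _,_; proj₁)
open import Data.Sum using (_⊎_; inj₁; inj₂; [_,_]′)
import Data.Sum as Sum
open import Data.Empty using (⊥-elim)
open import Data.List using (List; []; _∷_; length; allFin; cartesianProduct)
open import Data.List.Relation.Unary.Any using (here; there)
open import Data.List.Membership.Propositional using (_∈_; _∉_)
open import Data.List.Membership.Propositional.Properties using (∈-cartesianProduct⁺; ∈-allFin)
open import Function using (_∘_)
open import Relation.Nullary using (¬_; yes; no)
open import Relation.Binary.PropositionalEquality
open import Relation.Binary.PropositionalEquality.Properties using (decSetoid)

module Walks {V : Set} (G : Graph V) where

  private variable
    u v w x y z : V
    a b k : ℕ

  infixr 5 _++_

  _++_ : Walk G u w a → Walk G w v b → Walk G u v (a + b)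
  here     ++ q = q
  step e p ++ q = step e (p ++ q)

  _∷ʳ_ : Walk G u w k → adj G w v ≡ true → Walk G u v (suc k)
  here     ∷ʳ e = step e here
  step f p ∷ʳ e = step f (p ∷ʳ e)

  reverse : Walk G u v k → Walk G v u k
  reverse here                   = here
  reverse {u} (step {w = w} e p) = reverse p ∷ʳ trans (adj-sym G w u) e

  on-end : (p : Walk G u v k) → OnWalk G v p
  on-end here       = at-start
  on-end (step e p) = later (on-end p)

  on-++ʳ : (p : Walk G u w a) {q : Walk G w v b} → OnWalk G x q → OnWalk G x (p ++ q)
  on-++ʳ here       o = o
  on-++ʳ (step e p) o = later (on-++ʳ p o)

  walk-length-pos : Walk G u v k → u ≢ v → 0 < k
  walk-length-pos here       u≢u = ⊥-elim (u≢u refl)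
  walk-length-pos (step _ _) _   = s≤s z≤n

  tail-shortest : {e : adj G u w ≡ true} {p : Walk G w v k} →
                  IsShortest G (step e p) → IsShortest G p
  tail-shortest {e = e} sh j j<k q = sh (suc j) (s≤s j<k) (step e q)

  record Between (x y z : V) : Set where
    constructor between
    field
      {d₁ d₂}  : ℕ
      first    : Walk G x y d₁
      second   : Walk G y z d₂
      shortest : IsShortest G (first ++ second)

  between-sym : Between x y z → Between z y x
  between-sym (between {d₁} {d₂} q r sh) =
    between (reverse r) (reverse q)
      λ j j< p → sh j (subst (j <_) (+-comm d₂ d₁) j<) (reverse p)

  between⇒onCommonShortestPath : Between x y z → OnCommonShortestPath G x y z
  between⇒onCommonShortestPath (between q r sh) =
    _ , _ , _ , q ++ r , sh , at-start , on-++ʳ q at-start , on-++ʳ q (on-end r)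

  ¬between-adjacent : adj G x z ≡ true → y ≢ x → y ≢ z → ¬ Between x y z
  ¬between-adjacent e y≢x y≢z (between q r sh) =
    sh 1 (+-mono-≤ (walk-length-pos q (y≢x ∘ sym)) (walk-length-pos r y≢z)) (step e here)

  record Through (u y z v : V) (k : ℕ) : Set where
    constructor through
    field
      {d₁ d₂ d₃} : ℕ
      to-y       : Walk G u y d₁
      y-to-z     : Walk G y z d₂
      from-z     : Walk G z v d₃
      total      : d₁ + d₂ + d₃ ≡ k

  split : {p : Walk G u v k} → OnWalk G x p →
          Σ ℕ λ a → Σ ℕ λ b → Walk G u x a × Walk G x v b × a + b ≡ k
  split {k = k} {p = p} at-start = 0 , k , here , p , refl
  split (later {e = e} o) with split o
  ... | a , b , q , r , eq = suc a , b , step e q , r , cong suc eq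

  through-step : adj G u w ≡ true → Through w y z v k → Through u y z v (suc k)
  through-step e (through q r s eq) = through (step e q) r s (cong suc eq)

  visit-order : {p : Walk G u v k} → OnWalk G y p → OnWalk G z p →
                Through u y z v k ⊎ Through u z y v k
  visit-order at-start oz with split oz
  ... | _ , _ , q , r , eq = inj₁ (through here q r eq)
  visit-order (later {e = e} oy) at-start with split (later {e = e} oy)
  ... | _ , _ , q , r , eq = inj₂ (through here q r eq)
  visit-order (later {e = e} oy) (later oz) =
    Sum.map (through-step e) (through-step e) (visit-order oy oz)

  through⇒between : {p : Walk G u v k} → IsShortest G p → Through u y z v k → Between u y z
  through⇒between sh (through {d₃ = d₃} q r s eq) =
    between q r λ j j< p → sh (j + d₃) (subst (j + d₃ <_) eq (+-monoˡ-< d₃ j<)) (p ++ s)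

  Collinear : V → V → V → Set
  Collinear x y z = Between y x z ⊎ Between x y z ⊎ Between x z y

  collinear-from-start : {p : Walk G u v k} → IsShortest G p → OnWalk G y p → OnWalk G z p →
                         Between u y z ⊎ Between u z y
  collinear-from-start {p = p} sh oy oz =
    Sum.map (through⇒between {p = p} sh) (through⇒between {p = p} sh) (visit-order oy oz)

  collinear : {p : Walk G u v k} → IsShortest G p →
              OnWalk G x p → OnWalk G y p → OnWalk G z p → Collinear x y z
  collinear sh at-start oy oz = inj₂ (collinear-from-start sh oy oz)
  collinear sh (later ox) at-start oz =
    [ inj₁ , inj₂ ∘ inj₂ ∘ between-sym ]′ (collinear-from-start sh (later ox) oz)
  collinear sh (later {e = e} ox) (later oy) at-start =
    [ inj₁ ∘ between-sym , inj₂ ∘ inj₁ ∘ between-sym ]′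
      (collinear-from-start sh (later {e = e} ox) (later oy))
  collinear sh (later {e = e} {p = p} ox) (later oy) (later oz) =
    collinear (tail-shortest {e = e} {p = p} sh) ox oy oz

  onCommonShortestPath⇒collinear : OnCommonShortestPath G x y z → Collinear x y z
  onCommonShortestPath⇒collinear (_ , _ , _ , _ , sh , ox , oy , oz) = collinear sh ox oy oz

  onCommonShortestPath-swap₁₂ : OnCommonShortestPath G x y z → OnCommonShortestPath G y x z
  onCommonShortestPath-swap₁₂ (u , v , k , p , sh , ox , oy , oz) = u , v , k , p , sh , oy , ox , oz

  onCommonShortestPath-swap₂₃ : OnCommonShortestPath G x y z → OnCommonShortestPath G x z y
  onCommonShortestPath-swap₂₃ (u , v , k , p , sh , ox , oy , oz) = u , v , k , p , sh , ox , oz , oy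

  generalPosition-∷ : {S : List V} → GeneralPosition G S →
    (∀ y z → y ∈ S → z ∈ S → w ≢ y → y ≢ z → w ≢ z → ¬ OnCommonShortestPath G w y z) →
    GeneralPosition G (w ∷ S)
  generalPosition-∷ gp new x y z (here refl) (here refl) _ x≢y _ _ _ = x≢y refl
  generalPosition-∷ gp new x y z (here refl) _ (here refl) _ _ x≢z _ = x≢z refl
  generalPosition-∷ gp new x y z _ (here refl) (here refl) _ y≢z _ _ = y≢z refl
  generalPosition-∷ gp new x y z (here refl) (there y∈) (there z∈) x≢y y≢z x≢z =
    new y z y∈ z∈ x≢y y≢z x≢z
  generalPosition-∷ gp new x y z (there x∈) (here refl) (there z∈) x≢y y≢z x≢z =
    new x z x∈ z∈ (x≢y ∘ sym) x≢z y≢z ∘ onCommonShortestPath-swap₁₂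
  generalPosition-∷ gp new x y z (there x∈) (there y∈) (here refl) x≢y y≢z x≢z =
    new x y x∈ y∈ (x≢z ∘ sym) x≢y (y≢z ∘ sym)
      ∘ onCommonShortestPath-swap₁₂ ∘ onCommonShortestPath-swap₂₃
  generalPosition-∷ gp new x y z (there x∈) (there y∈) (there z∈) = gp x y z x∈ y∈ z∈

open Walks

module Automorphism {V : Set} (G : Graph V) (φ : V → V)
  (involutive : ∀ v → φ (φ v) ≡ v)
  (preserves-adj : ∀ {u v} → adj G u v ≡ true → adj G (φ u) (φ v) ≡ true) where

  private variable
    u v x y z : V
    k : ℕ

  φ-transpose : x ≡ φ y → φ x ≡ y
  φ-transpose {y = y} eq = trans (cong φ eq) (involutive y)

  φ-injective : φ x ≡ φ y → x ≡ y
  φ-injective {x} eq = trans (sym (involutive x)) (φ-transpose eq)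

  map-walk : Walk G u v k → Walk G (φ u) (φ v) k
  map-walk here       = here
  map-walk (step e p) = step (preserves-adj e) (map-walk p)

  unmap-walk : Walk G (φ u) (φ v) k → Walk G u v k
  unmap-walk {u} {v} {k} p = subst₂ (λ s t → Walk G s t k) (involutive u) (involutive v) (map-walk p)

  mirror-walk : Walk G u (φ v) k → Walk G (φ u) v k
  mirror-walk {u} {v} {k} p = subst (λ t → Walk G (φ u) t k) (involutive v) (map-walk p)

  map-on : {p : Walk G u v k} → OnWalk G x p → OnWalk G (φ x) (map-walk p)
  map-on at-start  = at-start
  map-on (later o) = later (map-on o)

  map-between : Between G x y z → Between G (φ x) (φ y) (φ z)
  map-between (between q r sh) =
    between (map-walk q) (map-walk r) λ j j< p → sh j j< (unmap-walk p)

  map-onCommonShortestPath : OnCommonShortestPath G x y z →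
                             OnCommonShortestPath G (φ x) (φ y) (φ z)
  map-onCommonShortestPath (u , v , k , p , sh , ox , oy , oz) =
    φ u , φ v , k , map-walk p , (λ j j< q → sh j j< (unmap-walk q)) ,
    map-on ox , map-on oy , map-on oz

record Mirror {V : Set} (H : Graph V) : Set where
  field
    φ             : V → V
    involutive    : ∀ v → φ (φ v) ≡ v
    preserves-adj : ∀ {u v} → adj H u v ≡ true → adj H (φ u) (φ v) ≡ true
    adjacent      : ∀ v → adj H v (φ v) ≡ true
    between-shift : ∀ a z → Between H (φ a) a z → Between H a z (φ z)

module MirrorStrategy {V : Set} {H : Graph V} (M : Mirror H) where

  open Mirror M
  open Automorphism H φ involutive preserves-adj
  open import Data.List.Countdown (decSetoid (_≟_ H))

  private variable
    a : V
    S : List V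

  φ-fixpoint-free : ∀ v → φ v ≢ v
  φ-fixpoint-free v φv≡v
    with trans (sym (adj-irrefl H v)) (subst (λ t → adj H v t ≡ true) φv≡v (adjacent v))
  ... | ()

  Symmetric : List V → Set
  Symmetric S = ∀ {v} → v ∈ S → φ v ∈ S

  symmetric-extend : Symmetric S → Symmetric (φ a ∷ a ∷ S)
  symmetric-extend {a = a} _ (here refl)   = there (here (involutive a))
  symmetric-extend _ (there (here refl))     = here refl
  symmetric-extend sym-S (there (there v∈S)) = there (there (sym-S v∈S))

  mirror-fresh : Symmetric S → a ∉ S → φ a ∉ a ∷ S
  mirror-fresh {a = a} _ _ (here φa≡a)       = φ-fixpoint-free a φa≡a
  mirror-fresh {a = a} sym-S a∉S (there φa∈S) = a∉S (subst (_∈ _) (involutive a) (sym-S φa∈S))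

  ¬between-mirror : Symmetric S → GeneralPosition H (a ∷ S) →
                    ∀ {w} → w ∈ S → w ≢ a → φ w ≢ a → ¬ Between H a w (φ w)
  ¬between-mirror {a = a} sym-S gp {w} w∈S w≢a φw≢a b =
    gp a w (φ w) (here refl) (there w∈S) (there (sym-S w∈S))
      (w≢a ∘ sym) (φ-fixpoint-free w ∘ sym) (φw≢a ∘ sym) (between⇒onCommonShortestPath H b)

  ¬onCommonShortestPath-pair : Symmetric S → GeneralPosition H (a ∷ S) →
    ∀ {z} → z ∈ S → z ≢ a → z ≢ φ a → ¬ OnCommonShortestPath H (φ a) a z
  ¬onCommonShortestPath-pair {a = a} sym-S gp {z} z∈S z≢a z≢φa oc
    with onCommonShortestPath⇒collinear H oc
  ... | inj₁ b = ¬between-mirror sym-S gp (sym-S z∈S)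
                   (z≢φa ∘ sym ∘ φ-transpose ∘ sym)
                   (z≢a ∘ trans (sym (involutive z)))
                   (between-shift a (φ z)
                     (subst (λ t → Between H (φ a) t (φ z)) (involutive a) (map-between b)))
  ... | inj₂ (inj₁ b) = ¬between-mirror sym-S gp z∈S z≢a (z≢φa ∘ sym ∘ φ-transpose ∘ sym)
                          (between-shift a z b)
  ... | inj₂ (inj₂ b) = ¬between-adjacent H (trans (adj-sym H (φ a) a) (adjacent a)) z≢φa z≢a b

  ¬onCommonShortestPath-image : Symmetric S → GeneralPosition H (a ∷ S) →
    ∀ {y z} → y ∈ S → z ∈ S → φ a ≢ y → y ≢ z → φ a ≢ z →
    ¬ OnCommonShortestPath H (φ a) y z
  ¬onCommonShortestPath-image {a = a} sym-S gp {y} {z} y∈S z∈S φa≢y y≢z φa≢z oc =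
    gp a (φ y) (φ z) (here refl) (there (sym-S y∈S)) (there (sym-S z∈S))
      (φa≢y ∘ φ-transpose) (y≢z ∘ φ-injective) (φa≢z ∘ φ-transpose)
      (subst (λ t → OnCommonShortestPath H t (φ y) (φ z)) (involutive a)
        (map-onCommonShortestPath oc))

  generalPosition-extend : Symmetric S → GeneralPosition H (a ∷ S) →
                           GeneralPosition H (φ a ∷ a ∷ S)
  generalPosition-extend {S} {a} sym-S gp = generalPosition-∷ H gp new-triple
    where
    new-triple : ∀ y z → y ∈ a ∷ S → z ∈ a ∷ S → φ a ≢ y → y ≢ z → φ a ≢ z →
                 ¬ OnCommonShortestPath H (φ a) y z
    new-triple y z (here refl) (here refl) _ y≢z _ _ = y≢z refl
    new-triple y z (here refl) (there z∈S) _ y≢z φa≢z =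
      ¬onCommonShortestPath-pair sym-S gp z∈S (y≢z ∘ sym) (φa≢z ∘ sym)
    new-triple y z (there y∈S) (here refl) φa≢y y≢z _ =
      ¬onCommonShortestPath-pair sym-S gp y∈S y≢z (φa≢y ∘ sym) ∘ onCommonShortestPath-swap₂₃ H
    new-triple y z (there y∈S) (there z∈S) =
      ¬onCommonShortestPath-image sym-S gp y∈S z∈S

  -- S ⊕ N bounds the number of unselected vertices by N; every round uses up two.
  mirror-loses : ∀ N S → S ⊕ N → Symmetric S → MoverLoses H S
  mirror-loses zero S count _ =
    allMoves λ v (v∉S , _) → ⊥-elim (v∉S (lookup! count v))
  mirror-loses (suc zero) S count sym-S =
    allMoves λ v (v∉S , _) →
      ⊥-elim (mirror-fresh sym-S v∉S (lookup! (insert count v v∉S) (φ v)))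
  mirror-loses (suc (suc N)) S count sym-S = allMoves reply
    where
    reply : ∀ v → Legal H S v → MoverWins H (v ∷ S)
    reply v (v∉S , gp) =
      move (φ v) (φv∉ , generalPosition-extend sym-S gp)
        (mirror-loses N (φ v ∷ v ∷ S) (insert (insert count v v∉S) (φ v) φv∉)
          (symmetric-extend sym-S))
      where
      φv∉ : φ v ∉ v ∷ S
      φv∉ = mirror-fresh sym-S v∉S

  mirror⇒BWins : (vs : List V) → (∀ v → v ∈ vs) → BWins H
  mirror⇒BWins vs complete = mirror-loses (length vs) [] (emptyFromList vs complete) λ ()


module Product {V W : Set} (G₁ : Graph V) (G₂ : Graph W) where

  private variable
    i j : V
    g h : W
    k : ℕ

  □-adj⁻ : adj (G₁ □ G₂) (i , g) (j , h) ≡ true →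
           (adj G₁ i j ≡ true × g ≡ h) ⊎ (i ≡ j × adj G₂ g h ≡ true)
  □-adj⁻ {i} {g} {j} {h} e with adj G₁ i j | _≟_ G₂ g h | _≟_ G₁ i j
  ... | true  | yes g≡h | _       = inj₁ (refl , g≡h)
  ... | true  | no _    | yes i≡j = inj₂ (i≡j , e)
  ... | false | _       | yes i≡j = inj₂ (i≡j , e)
  □-adj⁻ () | true  | no _ | no _
  □-adj⁻ () | false | _    | no _

  □-adj₁ : adj G₁ i j ≡ true → adj (G₁ □ G₂) (i , g) (j , g) ≡ true
  □-adj₁ {g = g} e rewrite e with _≟_ G₂ g g
  ... | yes _   = refl
  ... | no g≢g  = ⊥-elim (g≢g refl)

  □-adj₂ : adj G₂ g h ≡ true → adj (G₁ □ G₂) (i , g) (i , h) ≡ true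
  □-adj₂ {i = i} e rewrite adj-irrefl G₁ i with _≟_ G₁ i i
  ... | yes _  = e
  ... | no i≢i = ⊥-elim (i≢i refl)

  lift : Walk G₂ g h k → Walk (G₁ □ G₂) (i , g) (i , h) k
  lift here       = here
  lift (step e p) = step (□-adj₂ e) (lift p)

  project : Walk (G₁ □ G₂) (i , g) (j , h) k →
            Σ ℕ λ l → Walk G₂ g h l × l ≤ k × (i ≢ j → l < k)
  project here = 0 , here , z≤n , λ i≢i → ⊥-elim (i≢i refl)
  project (step e p) with □-adj⁻ e | project p
  ... | inj₁ (_ , refl) | l , q , l≤k , _   = l , q , m≤n⇒m≤1+n l≤k , λ _ → s≤s l≤k
  ... | inj₂ (refl , e₂) | l , q , l≤k , l<k =
    suc l , step e₂ q , s≤s l≤k , λ i≢j → s≤s (l<k i≢j)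

module CompleteProduct (n : ℕ) {m : ℕ} (G : Graph (Fin m)) (σ : Fin n → Fin n)
  (σ-involutive : ∀ i → σ (σ i) ≡ i) (σ-fixpoint-free : ∀ i → σ i ≢ i) where

  open Product (K n) G

  H : Graph (Fin n × Fin m)
  H = K n □ G

  private variable
    i j : Fin n
    g h : Fin m
    k : ℕ

  K-adj : i ≢ j → adj (K n) i j ≡ true
  K-adj {i} {j} i≢j with i ≟ᶠ j
  ... | yes i≡j = ⊥-elim (i≢j i≡j)
  ... | no _    = refl

  K-adj⁻ : adj (K n) i j ≡ true → i ≢ j
  K-adj⁻ {i} {j} e i≡j with i ≟ᶠ j
  K-adj⁻ () _ | yes _
  ... | no i≢j = i≢j i≡j

  mirror : Fin n × Fin m → Fin n × Fin m
  mirror (i , g) = σ i , g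

  mirror-involutive : ∀ v → mirror (mirror v) ≡ v
  mirror-involutive (i , g) = cong (_, g) (σ-involutive i)

  mirror-preserves-adj : ∀ {u v} → adj H u v ≡ true → adj H (mirror u) (mirror v) ≡ true
  mirror-preserves-adj {i , g} {j , h} e with □-adj⁻ {i} {g} {j} {h} e
  ... | inj₁ (eK , refl) = □-adj₁ (K-adj (K-adj⁻ eK ∘ σ-injective))
    where
    σ-injective : σ i ≡ σ j → i ≡ j
    σ-injective eq = trans (sym (σ-involutive i)) (trans (cong σ eq) (σ-involutive j))
  ... | inj₂ (refl , eG) = □-adj₂ {i = σ i} eG

  mirror-adjacent : ∀ v → adj H v (mirror v) ≡ true
  mirror-adjacent (i , g) = □-adj₁ (K-adj (σ-fixpoint-free i ∘ sym))

  open Automorphism H mirror mirror-involutive mirror-preserves-adj using (mirror-walk)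

  walk-across : ∀ i j → Walk G g h k → Σ ℕ λ l → l ≤ suc k × Walk H (i , g) (j , h) l
  walk-across {k = k} i j p with i ≟ᶠ j
  ... | yes refl = k , n≤1+n k , lift p
  ... | no i≢j   = suc k , ≤-refl , _∷ʳ_ H (lift p) (□-adj₁ (K-adj i≢j))

  -- Walks to (j , h) from (σ i , g) and from (i , g) differ by at most one
  -- K_n-step, so the hypothesis can only hold when i = j.
  no-shortcut⇒between : Walk H (i , g) (j , h) k →
    (∀ t → t ≤ k → ¬ Walk H (σ i , g) (j , h) t) → Between H (i , g) (j , h) (σ j , h)
  no-shortcut⇒between {i} {j = j} {h = h} r long with project r | i ≟ᶠ j
  ... | l , p , l≤k , _ | yes refl =
    between (lift p) (step (mirror-adjacent (i , h)) here) λ t t<l+1 w →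
      long t (≤-trans (≤-pred (subst (t <_) (+-comm l 1) t<l+1)) l≤k) (mirror-walk w)
  ... | _ , p , _ , l<k | no i≢j with walk-across (σ i) j p
  ...   | l′ , l′≤1+l , w = ⊥-elim (long l′ (≤-trans l′≤1+l (l<k i≢j)) w)

  mirror-between-shift : ∀ a z → Between H (mirror a) a z → Between H a z (mirror z)
  mirror-between-shift (i , g) (j , h) (between q r sh) =
    no-shortcut⇒between r λ t t≤ →
      sh t (≤-<-trans t≤ (m<n+m _ (walk-length-pos H q (σ-fixpoint-free i ∘ cong proj₁))))

  K□-mirror : Mirror H
  K□-mirror = record
    { φ             = mirror
    ; involutive    = mirror-involutive
    ; preserves-adj = mirror-preserves-adj
    ; adjacent      = mirror-adjacent
    ; between-shift = mirror-between-shift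
    }

opposite-fixpoint-free : ∀ {n} → n % 2 ≡ 0 → (i : Fin n) → opposite i ≢ i
opposite-fixpoint-free {n} n-even i opp≡i = 0≢1+n (begin
  0                 ≡⟨ sym n-even ⟩
  n % 2             ≡⟨ cong (_% 2) n-odd ⟩
  (1 + t * 2) % 2   ≡⟨ [m+kn]%n≡m%n 1 t 2 ⟩
  1                 ∎)
  where
  open ≡-Reasoning
  t : ℕ
  t = toℕ i
  n-odd : n ≡ 1 + t * 2
  n-odd = begin
    n                   ≡⟨ sym (m+[n∸m]≡n (toℕ<n i)) ⟩
    suc t + (n ∸ suc t) ≡⟨ cong (suc t +_) (trans (sym (opposite-prop i)) (cong toℕ opp≡i)) ⟩
    suc (t + t)         ≡⟨ cong (suc ∘ (t +_)) (sym (*-identityʳ t)) ⟩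
    suc (t + t * 1)     ≡⟨ cong suc (sym (*-suc t 1)) ⟩
    1 + t * 2           ∎

corollary3p7 : (n m : ℕ) → n % 2 ≡ 0 → 0 < m → (G : Graph (Fin m)) →
    Connected G → BWins (K n □ G)
corollary3p7 n m n-even _ G _ =
  MirrorStrategy.mirror⇒BWins
    (CompleteProduct.K□-mirror n G opposite opposite-involutive (opposite-fixpoint-free n-even))
    (cartesianProduct (allFin n) (allFin m))
    (λ (i , g) → ∈-cartesianProduct⁺ (∈-allFin i) (∈-allFin g))
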